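{- Let $P\subseteq\mathbb{Z}^2\setminus\{(0,0)\}$ be a finite set of pairwise non-colinear periods and let $x\in\Sigma^{\mathbb{Z}^2}$ be a configuration that avoids every period of $P$. Then there is a ball $B$ of radius $\sum_{p\in P}\|p\|_\infty$ (for the uniform norm) such that for every $p\in P$ there exists an avoidance $(w,w+p)$ of $p$ in $x$ with $w,w+p\in B$.
   Context: $\Sigma$ is a finite alphabet. An avoidance of $p$ in $x$ is a pair $(w,w+p)$ with $x_w\neq x_{w+p}$; $x$ avoids $p$ if such a pair exists. Balls are $B(c,r)=\{z\in\mathbb{Z}^2:\|z-c\|_\infty\le r\}$. -}

module Defs where

open import Data.Nat using (ℕ; _⊔_) renaming (_≤_ to _≤ℕ_)
open import Data.Integer using (ℤ; _+_; _-_; _*_; ∣_∣; +_)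
open import Data.Product using (_×_; _,_; ∃)
open import Data.List using (List; map)
open import Data.Nat.ListAction using (sum)
open import Data.Fin using (Fin)
open import Relation.Binary.PropositionalEquality using (_≡_; _≢_)
open import Relation.Nullary using (¬_)

ℤ² : Set
ℤ² = ℤ × ℤ

origin : ℤ²
origin = (+ 0 , + 0)

_⊕_ : ℤ² → ℤ² → ℤ²
(a , b) ⊕ (c , d) = (a + c , b + d)

‖_‖∞ : ℤ² → ℕ
‖ (a , b) ‖∞ = ∣ a ∣ ⊔ ∣ b ∣

_∈B[_,_] : ℤ² → ℤ² → ℕ → Set
(z₁ , z₂) ∈B[ (c₁ , c₂) , r ] = ‖ (z₁ - c₁ , z₂ - c₂) ‖∞ ≤ℕ r

Colinear : ℤ² → ℤ² → Set
Colinear (a , b) (c , d) = a * d ≡ b * c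

Config : ℕ → Set
Config k = ℤ² → Fin k

IsAvoidance : ∀ {k} → Config k → ℤ² → ℤ² → Set
IsAvoidance x p w = x w ≢ x (w ⊕ p)

Avoids : ∀ {k} → Config k → ℤ² → Set
Avoids x p = ∃ λ w → IsAvoidance x p w

normSum : List ℤ² → ℕ
normSum P = sum (map ‖_‖∞ P)

module Submission where

-- The proof is by induction on P.  Suppose all periods q of P′ have avoidances
-- inside a common ball B(c, r), where ‖q‖∞ ≤ r for q ∈ P′, and let p be a further
-- period, non-colinear with every q ∈ P′ and avoided somewhere by x.  We find a
-- centre c′ such that p and all q ∈ P′ have avoidances inside B(c′, ‖p‖∞ + r):
--
-- Starting from any p-avoidance w, look at w ± q for q ∈ P′.  If for
--      some q both w + q and w − q are p-avoidances, step to the one that is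
--      closer to the line through c in direction p (closeness is measured by the
--      cross product with p); otherwise every q has an avoidance next to w, and w
--      itself is a suitable centre.  The walk ends at a p-avoidance w* at
--      transverse distance at most ‖p‖∞·r from that line.
--   2. Centre.  Each translation either carries
--      all q-avoidances of B(c, r) along, or exhibits a p-avoidance in
--      B(c, ‖p‖∞ + r); once w* is centred along p, w* and w* + p lie in that ball.

open import Defs
open import Data.Nat as ℕ using (ℕ; zero; suc; _⊔_; z≤n) renaming (_≤_ to _≤ℕ_; _<_ to _<ℕ_)
import Data.Nat.Properties as ℕₚ
open import Data.Integer as ℤ using (ℤ; _+_; _-_; _*_; -_; +_; -[1+_]; ∣_∣; 0ℤ)
open import Data.Integer.Properties
  using ( ∣-i∣≡∣i∣; ∣i+j∣≤∣i∣+∣j∣; ∣i-j∣≤∣i∣+∣j∣; ∣i*j∣≡∣i∣*∣j∣; ⊖-≥; ∣m⊖n∣≡∣n⊖m∣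
        ; i-j≡0⇒i≡j; ∣i∣≡0⇒i≡0; +-identityʳ)
open import Data.Integer.Tactic.RingSolver using (solve-∀)
open import Data.Fin using (_≟_)
open import Data.Product using (_×_; _,_; ∃; Σ; proj₁; proj₂; swap)
open import Data.Sum using (_⊎_; inj₁; inj₂)
open import Data.List using (List; []; _∷_)
open import Data.List.Relation.Unary.All as All using (All; []; _∷_)
open import Data.List.Relation.Unary.AllPairs using (AllPairs; _∷_)
open import Data.Empty using (⊥-elim)
open import Relation.Binary.PropositionalEquality
open import Relation.Nullary using (¬_; Dec; yes; no)
open import Relation.Nullary.Decidable using (¬?; decidable-stable)

_⊟_ : ℤ² → ℤ² → ℤ²
(a , b) ⊟ (c , d) = (a - c , b - d)

neg : ℤ² → ℤ²
neg (a , b) = (- a , - b)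

cross : ℤ² → ℤ² → ℤ
cross (a , b) (c , d) = a * d - b * c

module _ where
  private
    pair : ∀ {a b c d : ℤ} → a ≡ c → b ≡ d → _≡_ {A = ℤ²} (a , b) (c , d)
    pair = cong₂ _,_

  ⊕-⊟ : ∀ w d c → (w ⊕ d) ⊟ c ≡ (w ⊟ c) ⊕ d
  ⊕-⊟ (w₁ , w₂) (d₁ , d₂) (c₁ , c₂) = pair (lemma w₁ d₁ c₁) (lemma w₂ d₂ c₂)
    where lemma : ∀ w d c → (w + d) - c ≡ (w - c) + d
          lemma = solve-∀

  ⊟-⊕ : ∀ w c d → w ⊟ (c ⊕ d) ≡ (w ⊟ c) ⊕ neg d
  ⊟-⊕ (w₁ , w₂) (c₁ , c₂) (d₁ , d₂) = pair (lemma w₁ c₁ d₁) (lemma w₂ c₂ d₂)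
    where lemma : ∀ w c d → w - (c + d) ≡ (w - c) + - d
          lemma = solve-∀

  ⊟-self : ∀ w → w ⊟ w ≡ origin
  ⊟-self (w₁ , w₂) = pair (lemma w₁) (lemma w₂)
    where lemma : ∀ w → w - w ≡ + 0
          lemma = solve-∀

  ⊕-⊟-cancel : ∀ w d → (w ⊕ d) ⊟ w ≡ d
  ⊕-⊟-cancel (w₁ , w₂) (d₁ , d₂) = pair (lemma w₁ d₁) (lemma w₂ d₂)
    where lemma : ∀ w d → (w + d) - w ≡ d
          lemma = solve-∀

  ⊕-⊟-translate : ∀ z c d → (z ⊕ d) ⊟ (c ⊕ d) ≡ z ⊟ c
  ⊕-⊟-translate (z₁ , z₂) (c₁ , c₂) (d₁ , d₂) = pair (lemma z₁ c₁ d₁) (lemma z₂ c₂ d₂)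
    where lemma : ∀ z c d → (z + d) - (c + d) ≡ z - c
          lemma = solve-∀

  ⊕-swap : ∀ w a b → (w ⊕ a) ⊕ b ≡ (w ⊕ b) ⊕ a
  ⊕-swap (w₁ , w₂) (a₁ , a₂) (b₁ , b₂) = pair (lemma w₁ a₁ b₁) (lemma w₂ a₂ b₂)
    where lemma : ∀ w a b → (w + a) + b ≡ (w + b) + a
          lemma = solve-∀

  ⊕-neg-cancel : ∀ w a → (w ⊕ neg a) ⊕ a ≡ w
  ⊕-neg-cancel (w₁ , w₂) (a₁ , a₂) = pair (lemma w₁ a₁) (lemma w₂ a₂)
    where lemma : ∀ w a → (w + - a) + a ≡ w
          lemma = solve-∀

  cross-⊕ : ∀ p u v → cross p (u ⊕ v) ≡ cross p u + cross p v
  cross-⊕ (p₁ , p₂) (u₁ , u₂) (v₁ , v₂) = lemma p₁ p₂ u₁ u₂ v₁ v₂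
    where lemma : ∀ p₁ p₂ u₁ u₂ v₁ v₂
                → p₁ * (u₂ + v₂) - p₂ * (u₁ + v₁) ≡ (p₁ * u₂ - p₂ * u₁) + (p₁ * v₂ - p₂ * v₁)
          lemma = solve-∀

  cross-neg : ∀ p u → cross p (neg u) ≡ - cross p u
  cross-neg (p₁ , p₂) (u₁ , u₂) = lemma p₁ p₂ u₁ u₂
    where lemma : ∀ p₁ p₂ u₁ u₂ → p₁ * (- u₂) - p₂ * (- u₁) ≡ - (p₁ * u₂ - p₂ * u₁)
          lemma = solve-∀

  cross-self : ∀ p → cross p p ≡ 0ℤ
  cross-self (p₁ , p₂) = lemma p₁ p₂
    where lemma : ∀ p₁ p₂ → p₁ * p₂ - p₂ * p₁ ≡ 0ℤ
          lemma = solve-∀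

  cross-swap : ∀ p u → cross (swap p) (swap u) ≡ - cross p u
  cross-swap (p₁ , p₂) (u₁ , u₂) = lemma p₁ p₂ u₁ u₂
    where lemma : ∀ p₁ p₂ u₁ u₂ → p₂ * u₁ - p₁ * u₂ ≡ - (p₁ * u₂ - p₂ * u₁)
          lemma = solve-∀

parallel-neg : ∀ p {d} → cross p d ≡ 0ℤ → cross p (neg d) ≡ 0ℤ
parallel-neg p {d} pd≡0 = trans (cross-neg p d) (cong -_ pd≡0)

cross-neg-self : ∀ p → cross p (neg p) ≡ 0ℤ
cross-neg-self p = parallel-neg p (cross-self p)

cross-parallel : ∀ p u d → cross p d ≡ 0ℤ → cross p (u ⊕ d) ≡ cross p u
cross-parallel p u d pd≡0 = begin
  cross p (u ⊕ d)         ≡⟨ cross-⊕ p u d ⟩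
  cross p u + cross p d   ≡⟨ cong (_+_ (cross p u)) pd≡0 ⟩
  cross p u + 0ℤ          ≡⟨ +-identityʳ (cross p u) ⟩
  cross p u               ∎
  where open ≡-Reasoning

non-colinear⇒cross≢0 : ∀ p {q} → ¬ Colinear p q → cross p q ≢ 0ℤ
non-colinear⇒cross≢0 (p₁ , p₂) {q₁ , q₂} ¬col eq = ¬col (i-j≡0⇒i≡j (p₁ * q₂) (p₂ * q₁) eq)

norm-⊕ : ∀ u v → ‖ u ⊕ v ‖∞ ≤ℕ ‖ u ‖∞ ℕ.+ ‖ v ‖∞
norm-⊕ (a , b) (c , d) = ℕₚ.⊔-lub
  (ℕₚ.≤-trans (∣i+j∣≤∣i∣+∣j∣ a c) (ℕₚ.+-mono-≤ (ℕₚ.m≤m⊔n ∣ a ∣ ∣ b ∣) (ℕₚ.m≤m⊔n ∣ c ∣ ∣ d ∣)))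
  (ℕₚ.≤-trans (∣i+j∣≤∣i∣+∣j∣ b d) (ℕₚ.+-mono-≤ (ℕₚ.m≤n⊔m ∣ a ∣ ∣ b ∣) (ℕₚ.m≤n⊔m ∣ c ∣ ∣ d ∣)))

norm-neg : ∀ u → ‖ neg u ‖∞ ≡ ‖ u ‖∞
norm-neg (a , b) = cong₂ _⊔_ (∣-i∣≡∣i∣ a) (∣-i∣≡∣i∣ b)

norm-swap : ∀ u → ‖ swap u ‖∞ ≡ ‖ u ‖∞
norm-swap (a , b) = ℕₚ.⊔-comm ∣ b ∣ ∣ a ∣

norm-pos : ∀ u → u ≢ origin → 1 ≤ℕ ‖ u ‖∞
norm-pos (a , b) u≢0 = ℕₚ.n≢0⇒n>0 λ ‖u‖≡0 →
  u≢0 (cong₂ _,_ (∣i∣≡0⇒i≡0 (ℕₚ.n≤0⇒n≡0 (subst (∣ a ∣ ≤ℕ_) ‖u‖≡0 (ℕₚ.m≤m⊔n ∣ a ∣ ∣ b ∣))))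
                 (∣i∣≡0⇒i≡0 (ℕₚ.n≤0⇒n≡0 (subst (∣ b ∣ ≤ℕ_) ‖u‖≡0 (ℕₚ.m≤n⊔m ∣ a ∣ ∣ b ∣)))))

cross-bound : ∀ p q → ∣ cross p q ∣ ≤ℕ ‖ p ‖∞ ℕ.* ‖ q ‖∞ ℕ.+ ‖ p ‖∞ ℕ.* ‖ q ‖∞
cross-bound (a , b) (c , d) = begin
  ∣ a * d - b * c ∣               ≤⟨ ∣i-j∣≤∣i∣+∣j∣ (a * d) (b * c) ⟩
  ∣ a * d ∣ ℕ.+ ∣ b * c ∣          ≡⟨ cong₂ ℕ._+_ (∣i*j∣≡∣i∣*∣j∣ a d) (∣i*j∣≡∣i∣*∣j∣ b c) ⟩
  ∣ a ∣ ℕ.* ∣ d ∣ ℕ.+ ∣ b ∣ ℕ.* ∣ c ∣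
    ≤⟨ ℕₚ.+-mono-≤ (ℕₚ.*-mono-≤ (ℕₚ.m≤m⊔n ∣ a ∣ ∣ b ∣) (ℕₚ.m≤n⊔m ∣ c ∣ ∣ d ∣))
                   (ℕₚ.*-mono-≤ (ℕₚ.m≤n⊔m ∣ a ∣ ∣ b ∣) (ℕₚ.m≤m⊔n ∣ c ∣ ∣ d ∣)) ⟩
  ‖ (a , b) ‖∞ ℕ.* ‖ (c , d) ‖∞ ℕ.+ ‖ (a , b) ‖∞ ℕ.* ‖ (c , d) ‖∞ ∎
  where open ℕₚ.≤-Reasoning

norm≤normSum : ∀ P → All (λ q → ‖ q ‖∞ ≤ℕ normSum P) P
norm≤normSum []      = []
norm≤normSum (p ∷ P) = ℕₚ.m≤m+n ‖ p ‖∞ (normSum P)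
                     ∷ All.map (λ q≤ → ℕₚ.≤-trans q≤ (ℕₚ.m≤n+m (normSum P) ‖ p ‖∞)) (norm≤normSum P)

nonzero⇒1≤∣∣ : ∀ {i} → i ≢ 0ℤ → 1 ≤ℕ ∣ i ∣
nonzero⇒1≤∣∣ i≢0 = ℕₚ.n≢0⇒n>0 (λ ∣i∣≡0 → i≢0 (∣i∣≡0⇒i≡0 ∣i∣≡0))

⊖-shrinks : ∀ m f → 1 ≤ℕ f → f <ℕ m ℕ.+ m → ∣ m ℤ.⊖ f ∣ <ℕ m
⊖-shrinks m f 1≤f f<2m with ℕₚ.≤-total f m
... | inj₁ f≤m rewrite ⊖-≥ f≤m = ℕₚ.∸-monoʳ-< {m} {f} {0} 1≤f f≤m
... | inj₂ m≤f rewrite ∣m⊖n∣≡∣n⊖m∣ m f | ⊖-≥ m≤f =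
  subst ((f ℕ.∸ m) <ℕ_) (ℕₚ.m+n∸n≡m m m) (ℕₚ.∸-monoˡ-< {f} {m} {m ℕ.+ m} f<2m m≤f)

closer : ∀ m f → 1 ≤ℕ ∣ f ∣ → ∣ f ∣ <ℕ ∣ m ∣ ℕ.+ ∣ m ∣ → ∣ m - f ∣ <ℕ ∣ m ∣ ⊎ ∣ m + f ∣ <ℕ ∣ m ∣
closer (+ m)     (+ suc f)  1≤f f<2m = inj₁ (⊖-shrinks m (suc f) 1≤f f<2m)
closer (+ m)     -[1+ f ]   1≤f f<2m = inj₂ (⊖-shrinks m (suc f) 1≤f f<2m)
closer -[1+ m ]  (+ suc f)  1≤f f<2m =
  inj₂ (subst (_<ℕ suc m) (∣m⊖n∣≡∣n⊖m∣ (suc m) (suc f)) (⊖-shrinks (suc m) (suc f) 1≤f f<2m))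
closer -[1+ m ]  -[1+ f ]   1≤f f<2m =
  inj₁ (subst (_<ℕ suc m) (∣m⊖n∣≡∣n⊖m∣ (suc m) (suc f)) (⊖-shrinks (suc m) (suc f) 1≤f f<2m))

closer-double : ∀ m a → 1 ≤ℕ ∣ a ∣ → ∣ a ∣ <ℕ ∣ m ∣ → ∣ m - + 2 * a ∣ <ℕ ∣ m ∣ ⊎ ∣ m + + 2 * a ∣ <ℕ ∣ m ∣
closer-double m a 1≤a a<m =
  closer m (+ 2 * a) (ℕₚ.≤-trans 1≤a (subst (∣ a ∣ ≤ℕ_) (sym twice) (ℕₚ.m≤m+n ∣ a ∣ ∣ a ∣)))
                     (subst (_<ℕ ∣ m ∣ ℕ.+ ∣ m ∣) (sym twice) (ℕₚ.+-mono-< a<m a<m))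
  where
    twice : ∣ + 2 * a ∣ ≡ ∣ a ∣ ℕ.+ ∣ a ∣
    twice = trans (∣i*j∣≡∣i∣*∣j∣ (+ 2) a) (cong (∣ a ∣ ℕ.+_) (ℕₚ.+-identityʳ ∣ a ∣))

halves : ∀ s a → ∣ + 2 * s + a ∣ ≤ℕ ∣ a ∣ → ∣ s ∣ ≤ℕ ∣ a ∣ × ∣ s + a ∣ ≤ℕ ∣ a ∣
halves s a h = ℕₚ.*-cancelˡ-≤ 2 (bound _-_ s (lemma₁ s a) ∣i-j∣≤∣i∣+∣j∣)
             , ℕₚ.*-cancelˡ-≤ 2 (bound _+_ (s + a) (lemma₂ s a) ∣i+j∣≤∣i∣+∣j∣)
  where
    lemma₁ : ∀ s a → + 2 * s ≡ (+ 2 * s + a) - a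
    lemma₁ = solve-∀
    lemma₂ : ∀ s a → + 2 * (s + a) ≡ (+ 2 * s + a) + a
    lemma₂ = solve-∀
    open ℕₚ.≤-Reasoning
    -- 2t = (2s + a) ∓ a for t = s, s + a; hence |2t| ≤ |2s + a| + |a| ≤ 2|a|.
    bound : ∀ (_∙_ : ℤ → ℤ → ℤ) t → + 2 * t ≡ (+ 2 * s + a) ∙ a
          → (∀ i j → ∣ i ∙ j ∣ ≤ℕ ∣ i ∣ ℕ.+ ∣ j ∣) → 2 ℕ.* ∣ t ∣ ≤ℕ 2 ℕ.* ∣ a ∣
    bound _∙_ t eq tri = begin
      2 ℕ.* ∣ t ∣                 ≡⟨ sym (∣i*j∣≡∣i∣*∣j∣ (+ 2) t) ⟩
      ∣ + 2 * t ∣                 ≡⟨ cong ∣_∣ eq ⟩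
      ∣ (+ 2 * s + a) ∙ a ∣       ≤⟨ tri (+ 2 * s + a) a ⟩
      ∣ + 2 * s + a ∣ ℕ.+ ∣ a ∣    ≤⟨ ℕₚ.+-monoˡ-≤ ∣ a ∣ h ⟩
      ∣ a ∣ ℕ.+ ∣ a ∣              ≡⟨ cong (∣ a ∣ ℕ.+_) (sym (ℕₚ.+-identityʳ ∣ a ∣)) ⟩
      2 ℕ.* ∣ a ∣                  ∎

cross-controls : ∀ a b s t r → 1 ≤ℕ ∣ a ∣ → ∣ b ∣ ≤ℕ ∣ a ∣ → ∣ s ∣ ≤ℕ ∣ a ∣
  → ∣ a * t - b * s ∣ ≤ℕ ∣ a ∣ ℕ.* r → ∣ t ∣ ≤ℕ r ℕ.+ ∣ b ∣
cross-controls a b s t r 1≤a b≤a s≤a small = ℕₚ.*-cancelˡ-≤ ∣ a ∣ {{ℕ.>-nonZero 1≤a}} (begin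
  ∣ a ∣ ℕ.* ∣ t ∣                  ≡⟨ sym (∣i*j∣≡∣i∣*∣j∣ a t) ⟩
  ∣ a * t ∣                        ≡⟨ cong ∣_∣ (lemma a t b s) ⟩
  ∣ (a * t - b * s) + b * s ∣      ≤⟨ ∣i+j∣≤∣i∣+∣j∣ (a * t - b * s) (b * s) ⟩
  ∣ a * t - b * s ∣ ℕ.+ ∣ b * s ∣   ≤⟨ ℕₚ.+-mono-≤ small (ℕₚ.≤-reflexive (∣i*j∣≡∣i∣*∣j∣ b s)) ⟩
  ∣ a ∣ ℕ.* r ℕ.+ ∣ b ∣ ℕ.* ∣ s ∣   ≤⟨ ℕₚ.+-monoʳ-≤ (∣ a ∣ ℕ.* r) (ℕₚ.*-monoʳ-≤ ∣ b ∣ s≤a) ⟩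
  ∣ a ∣ ℕ.* r ℕ.+ ∣ b ∣ ℕ.* ∣ a ∣   ≡⟨ cong (∣ a ∣ ℕ.* r ℕ.+_) (ℕₚ.*-comm ∣ b ∣ ∣ a ∣) ⟩
  ∣ a ∣ ℕ.* r ℕ.+ ∣ a ∣ ℕ.* ∣ b ∣   ≡⟨ sym (ℕₚ.*-distribˡ-+ (∣ a ∣) r (∣ b ∣)) ⟩
  ∣ a ∣ ℕ.* (r ℕ.+ ∣ b ∣)          ∎)
  where
    open ℕₚ.≤-Reasoning
    lemma : ∀ a t b s → a * t ≡ (a * t - b * s) + b * s
    lemma = solve-∀

-- A coordinate of p realising ‖p‖∞.  In that coordinate, and transversally to p
-- (through the cross product), a vector u is controlled, and then so is ‖u‖∞.
record Dominant (p : ℤ²) : Set where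
  field
    sel     : ℤ² → ℤ
    sel-⊕   : ∀ u v → sel (u ⊕ v) ≡ sel u + sel v
    sel-neg : ∀ u → sel (neg u) ≡ - sel u
    sel-p   : ∣ sel p ∣ ≡ ‖ p ‖∞
    box     : ∀ r u → ∣ sel u ∣ ≤ℕ ‖ p ‖∞ → ∣ cross p u ∣ ≤ℕ ‖ p ‖∞ ℕ.* r → ‖ u ‖∞ ≤ℕ ‖ p ‖∞ ℕ.+ r

box-first : ∀ a b r s t → ∣ b ∣ ≤ℕ ∣ a ∣ → 1 ≤ℕ ∣ a ∣ → ∣ s ∣ ≤ℕ ∣ a ∣
  → ∣ a * t - b * s ∣ ≤ℕ ∣ a ∣ ℕ.* r → ∣ s ∣ ⊔ ∣ t ∣ ≤ℕ ∣ a ∣ ℕ.+ r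
box-first a b r s t b≤a 1≤a s≤a small = ℕₚ.⊔-lub (ℕₚ.≤-trans s≤a (ℕₚ.m≤m+n ∣ a ∣ r)) (begin
  ∣ t ∣          ≤⟨ cross-controls a b s t r 1≤a b≤a s≤a small ⟩
  r ℕ.+ ∣ b ∣    ≤⟨ ℕₚ.+-monoʳ-≤ r b≤a ⟩
  r ℕ.+ ∣ a ∣    ≡⟨ ℕₚ.+-comm r ∣ a ∣ ⟩
  ∣ a ∣ ℕ.+ r    ∎)
  where open ℕₚ.≤-Reasoning

dominant : ∀ p → p ≢ origin → Dominant p
dominant (a , b) p≢0 with ℕₚ.≤-total ∣ b ∣ ∣ a ∣
... | inj₁ b≤a =
  record { sel = proj₁ ; sel-⊕ = λ _ _ → refl ; sel-neg = λ _ → refl ; sel-p = sym ‖p‖≡a ; box = box }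
  where
    ‖p‖≡a : ‖ (a , b) ‖∞ ≡ ∣ a ∣
    ‖p‖≡a = ℕₚ.m≥n⇒m⊔n≡m b≤a
    box : ∀ r u → ∣ proj₁ u ∣ ≤ℕ ‖ (a , b) ‖∞ → ∣ cross (a , b) u ∣ ≤ℕ ‖ (a , b) ‖∞ ℕ.* r
      → ‖ u ‖∞ ≤ℕ ‖ (a , b) ‖∞ ℕ.+ r
    box r (s , t) s≤p small rewrite ‖p‖≡a =
      box-first a b r s t b≤a (subst (1 ≤ℕ_) ‖p‖≡a (norm-pos (a , b) p≢0)) s≤p small
... | inj₂ a≤b =
  record { sel = proj₂ ; sel-⊕ = λ _ _ → refl ; sel-neg = λ _ → refl ; sel-p = sym ‖p‖≡b ; box = box }
  where
    ‖p‖≡b : ‖ (a , b) ‖∞ ≡ ∣ b ∣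
    ‖p‖≡b = ℕₚ.m≤n⇒m⊔n≡n a≤b
    box : ∀ r u → ∣ proj₂ u ∣ ≤ℕ ‖ (a , b) ‖∞ → ∣ cross (a , b) u ∣ ≤ℕ ‖ (a , b) ‖∞ ℕ.* r
      → ‖ u ‖∞ ≤ℕ ‖ (a , b) ‖∞ ℕ.+ r
    box r (s , t) t≤p small rewrite ‖p‖≡b =
      subst (_≤ℕ ∣ b ∣ ℕ.+ r) (norm-swap (s , t))
        (box-first b a r t s a≤b (subst (1 ≤ℕ_) ‖p‖≡b (norm-pos (a , b) p≢0)) t≤p
                   (subst (_≤ℕ ∣ b ∣ ℕ.* r) swapped small))
      where
        swapped : ∣ cross (a , b) (s , t) ∣ ≡ ∣ cross (b , a) (t , s) ∣
        swapped = trans (sym (∣-i∣≡∣i∣ (cross (a , b) (s , t)))) (cong ∣_∣ (sym (cross-swap (a , b) (s , t))))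

ball-centre : ∀ w {r} → w ∈B[ w , r ]
ball-centre w = subst (λ u → ‖ u ‖∞ ≤ℕ _) (sym (⊟-self w)) z≤n

ball-step : ∀ w d → (w ⊕ d) ∈B[ w , ‖ d ‖∞ ]
ball-step w d = ℕₚ.≤-reflexive (cong ‖_‖∞ (⊕-⊟-cancel w d))

ball-weaken : ∀ z c {r s} → r ≤ℕ s → z ∈B[ c , r ] → z ∈B[ c , s ]
ball-weaken z c r≤s z∈B = ℕₚ.≤-trans z∈B r≤s

ball-add : ∀ z c {r} d → z ∈B[ c , r ] → (z ⊕ d) ∈B[ c , r ℕ.+ ‖ d ‖∞ ]
ball-add z c {r} d z∈B = begin
  ‖ (z ⊕ d) ⊟ c ‖∞         ≡⟨ cong ‖_‖∞ (⊕-⊟ z d c) ⟩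
  ‖ (z ⊟ c) ⊕ d ‖∞         ≤⟨ norm-⊕ (z ⊟ c) d ⟩
  ‖ z ⊟ c ‖∞ ℕ.+ ‖ d ‖∞     ≤⟨ ℕₚ.+-monoˡ-≤ ‖ d ‖∞ z∈B ⟩
  r ℕ.+ ‖ d ‖∞             ∎
  where open ℕₚ.≤-Reasoning

ball-translate : ∀ z c {r} d → z ∈B[ c , r ] → (z ⊕ d) ∈B[ c ⊕ d , r ]
ball-translate z c d z∈B = subst (λ u → ‖ u ‖∞ ≤ℕ _) (sym (⊕-⊟-translate z c d)) z∈B

AvoidsIn : ∀ {k} → Config k → ℤ² → ℕ → ℤ² → Set
AvoidsIn x c r q = ∃ λ w → IsAvoidance x q w × w ∈B[ c , r ] × (w ⊕ q) ∈B[ c , r ]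

-- Over a finite alphabet, being an avoidance is decidable, so a non-avoidance is an equality.
avoidance? : ∀ {k} (x : Config k) q w → Dec (IsAvoidance x q w)
avoidance? x q w = ¬? (x w ≟ x (w ⊕ q))

non-avoidance : ∀ {k} (x : Config k) {q w} → ¬ IsAvoidance x q w → x w ≡ x (w ⊕ q)
non-avoidance x {q} {w} = decidable-stable (x w ≟ x (w ⊕ q))

avoidsIn-weaken : ∀ {k} {x : Config k} {c r s q} → r ≤ℕ s → AvoidsIn x c r q → AvoidsIn x c s q
avoidsIn-weaken {c = c} {q = q} r≤s (w , av , w∈B , wq∈B) =
  w , av , ball-weaken w c r≤s w∈B , ball-weaken (w ⊕ q) c r≤s wq∈B

-- An avoidance (y, y − q) of −q is the avoidance (y − q, y) of q.
avoidsIn-neg : ∀ {k} {x : Config k} {c r q} → AvoidsIn x c r (neg q) → AvoidsIn x c r q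
avoidsIn-neg {x = x} {c} {r} {q} (y , av , y∈B , y-q∈B) =
  y ⊕ neg q , (λ eq → av (sym (trans eq (cong x back)))) , y-q∈B , subst (_∈B[ c , r ]) (sym back) y∈B
  where back = ⊕-neg-cancel y q

-- If w avoids p but w + q does not, then q is avoided within distance ‖p‖ + ‖q‖ of w:
-- either at w itself, or else at w + p.
avoidance-near : ∀ {k} (x : Config k) {p q w} → IsAvoidance x p w → ¬ IsAvoidance x p (w ⊕ q)
  → AvoidsIn x w (‖ p ‖∞ ℕ.+ ‖ q ‖∞) q
avoidance-near x {p} {q} {w} avw ¬avwq with x w ≟ x (w ⊕ q)
... | no  ne  = w , ne , ball-centre w , ball-weaken (w ⊕ q) w (ℕₚ.m≤n+m ‖ q ‖∞ ‖ p ‖∞) (ball-step w q)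
... | yes eq  = w ⊕ p , ne′ , ball-weaken (w ⊕ p) w (ℕₚ.m≤m+n ‖ p ‖∞ ‖ q ‖∞) (ball-step w p)
                , ball-add (w ⊕ p) w q (ball-step w p)
  where
    ne′ : IsAvoidance x q (w ⊕ p)
    ne′ eq′ = avw (begin
      x w               ≡⟨ eq ⟩
      x (w ⊕ q)         ≡⟨ non-avoidance x ¬avwq ⟩
      x ((w ⊕ q) ⊕ p)   ≡⟨ cong x (⊕-swap w q p) ⟩
      x ((w ⊕ p) ⊕ q)   ≡⟨ sym eq′ ⟩
      x (w ⊕ p)         ∎)
      where open ≡-Reasoning

near-or-blocked : ∀ {k} (x : Config k) {p w} → IsAvoidance x p w → ∀ q
  → AvoidsIn x w (‖ p ‖∞ ℕ.+ ‖ q ‖∞) q ⊎ (IsAvoidance x p (w ⊕ q) × IsAvoidance x p (w ⊕ neg q))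
near-or-blocked x {p} {w} avw q with avoidance? x p (w ⊕ q) | avoidance? x p (w ⊕ neg q)
... | no ¬av₊ | _       = inj₁ (avoidance-near x avw ¬av₊)
... | yes _   | no ¬av₋ =
  inj₁ (avoidsIn-neg (subst (λ n → AvoidsIn x w (‖ p ‖∞ ℕ.+ n) (neg q)) (norm-neg q) (avoidance-near x avw ¬av₋)))
... | yes av₊ | yes av₋ = inj₂ (av₊ , av₋)

-- Translating a q-avoidance of B(c, r) by d: either the translated pair is a q-avoidance in
-- B(c + d, r), or x is not d-periodic at one of its ends, giving a d-avoidance in B(c, r + ‖d‖).
translate-or-avoid : ∀ {k} (x : Config k) {c r q} d → AvoidsIn x c r q
  → AvoidsIn x (c ⊕ d) r q ⊎ AvoidsIn x c (r ℕ.+ ‖ d ‖∞) d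
translate-or-avoid x {c} {r} {q} d (w , av , w∈B , wq∈B) with avoidance? x d w | avoidance? x d (w ⊕ q)
... | yes avd | _       = inj₂ (w , avd , ball-weaken w c (ℕₚ.m≤m+n r ‖ d ‖∞) w∈B , ball-add w c d w∈B)
... | no _    | yes avd =
  inj₂ (w ⊕ q , avd , ball-weaken (w ⊕ q) c (ℕₚ.m≤m+n r ‖ d ‖∞) wq∈B , ball-add (w ⊕ q) c d wq∈B)
... | no ¬av₁ | no ¬av₂ =
  inj₁ (w ⊕ d , av′ , ball-translate w c d w∈B
       , subst (_∈B[ c ⊕ d , r ]) (⊕-swap w q d) (ball-translate (w ⊕ q) c d wq∈B))
  where
    av′ : IsAvoidance x q (w ⊕ d)
    av′ eq = av (begin
      x w               ≡⟨ non-avoidance x ¬av₁ ⟩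
      x (w ⊕ d)         ≡⟨ eq ⟩
      x ((w ⊕ d) ⊕ q)   ≡⟨ cong x (sym (⊕-swap w q d)) ⟩
      x ((w ⊕ q) ⊕ d)   ≡⟨ sym (non-avoidance x ¬av₂) ⟩
      x (w ⊕ q)         ∎)
      where open ≡-Reasoning

all-or-some : ∀ {A : Set} {P Q : A → Set} {L : List A} → All (λ a → P a ⊎ Q a) L → All P L ⊎ ∃ Q
all-or-some []               = inj₁ []
all-or-some (inj₂ q  ∷ _)    = inj₂ (_ , q)
all-or-some (inj₁ p  ∷ rest) with all-or-some rest
... | inj₁ ps = inj₁ (p ∷ ps)
... | inj₂ q  = inj₂ q

descend : ∀ {S G : Set} (μ : S → ℕ) → (∀ s → G ⊎ ∃ λ s′ → μ s′ <ℕ μ s) → S → G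
descend {G = G} μ step s = go (μ s) s ℕₚ.≤-refl
  where
    go : ∀ n s → μ s ≤ℕ n → G
    go n s μs≤n with step s
    ... | inj₁ g = g
    go zero    s μs≤n | inj₂ (s′ , lt) = ⊥-elim (ℕₚ.n≮0 (ℕₚ.<-≤-trans lt μs≤n))
    go (suc n) s μs≤n | inj₂ (s′ , lt) = go n s′ (ℕ.s≤s⁻¹ (ℕₚ.<-≤-trans lt μs≤n))

module Extend {k} (x : Config k) (p : ℤ²) (r : ℕ) (P′ : List ℤ²)
              (p≢0 : p ≢ origin)
              (short : All (λ q → ‖ q ‖∞ ≤ℕ r) P′)
              (transversal : All (λ q → cross p q ≢ 0ℤ) P′) where

  ‖p‖ : ℕ
  ‖p‖ = ‖ p ‖∞

  R : ℕ
  R = ‖p‖ ℕ.+ r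

  Covered : ℤ² → Set
  Covered c = All (AvoidsIn x c r) P′

  Goal : ℤ² → Set
  Goal c = All (AvoidsIn x c R) (p ∷ P′)

  covered⇒goal : ∀ {c} → AvoidsIn x c R p → Covered c → Goal c
  covered⇒goal avp cov = avp ∷ All.map (avoidsIn-weaken (ℕₚ.m≤n+m r ‖p‖)) cov

  shift : ∀ {c} d → ‖ d ‖∞ ≡ ‖p‖ → (AvoidsIn x c R d → AvoidsIn x c R p) → Covered c
    → Goal c ⊎ Covered (c ⊕ d)
  shift {c} d ‖d‖≡‖p‖ toP cov
    with all-or-some {P = AvoidsIn x (c ⊕ d) r} {Q = λ _ → AvoidsIn x c (r ℕ.+ ‖ d ‖∞) d}
                     (All.map (translate-or-avoid x d) cov)
  ... | inj₁ cov′       = inj₂ cov′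
  ... | inj₂ (_ , avd) = inj₁ (covered⇒goal (toP (subst (λ n → AvoidsIn x c n d) radius avd)) cov)
    where radius = trans (cong (r ℕ.+_) ‖d‖≡‖p‖) (ℕₚ.+-comm r ‖p‖)

  -- Phase 1 ends with a p-avoidance at transverse distance at most ‖p‖·r from the line
  -- through c in direction p (distances measured by the cross product with p).
  Near : ℤ² → Set
  Near c = ∃ λ w → IsAvoidance x p w × ∣ cross p (w ⊟ c) ∣ ≤ℕ ‖p‖ ℕ.* r

  Blocking : ℤ² → ℤ² → Set
  Blocking w q = (‖ q ‖∞ ≤ℕ r × cross p q ≢ 0ℤ) × IsAvoidance x p (w ⊕ q) × IsAvoidance x p (w ⊕ neg q)

  centred-or-blocked : ∀ {w} → IsAvoidance x p w → Goal w ⊎ ∃ (Blocking w)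
  centred-or-blocked {w} avw with all-or-some (All.zipWith classify (short , transversal))
    where
      classify : ∀ {q} → ‖ q ‖∞ ≤ℕ r × cross p q ≢ 0ℤ
        → AvoidsIn x w R q ⊎ Blocking w q
      classify {q} (q≤r , q∦p) with near-or-blocked x avw q
      ... | inj₁ near = inj₁ (avoidsIn-weaken (ℕₚ.+-monoʳ-≤ ‖p‖ q≤r) near)
      ... | inj₂ bl   = inj₂ ((q≤r , q∦p) , bl)
  ... | inj₁ near    = inj₁ (avp ∷ near)
    where avp = w , avw , ball-centre w , ball-weaken (w ⊕ p) w (ℕₚ.m≤m+n ‖p‖ r) (ball-step w p)
  ... | inj₂ blocked = inj₂ blocked

  walk : ∀ c → Avoids x p → ∃ Goal ⊎ Near c
  walk c = descend (λ (w , _) → ∣ K w ∣) step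
    where
      K : ℤ² → ℤ
      K w = cross p (w ⊟ c)

      K-advance : ∀ w d → K (w ⊕ d) ≡ K w + cross p d
      K-advance w d = trans (cong (cross p) (⊕-⊟ w d c)) (cross-⊕ p (w ⊟ c) d)

      K-retreat : ∀ w d → K (w ⊕ neg d) ≡ K w - cross p d
      K-retreat w d = trans (K-advance w (neg d)) (cong (_+_ (K w)) (cross-neg p d))

      short-step : ∀ w q → ‖p‖ ℕ.* r <ℕ ∣ K w ∣ → ‖ q ‖∞ ≤ℕ r → ∣ cross p q ∣ <ℕ ∣ K w ∣ ℕ.+ ∣ K w ∣
      short-step w q far q≤r = ℕₚ.≤-<-trans (cross-bound p q) (ℕₚ.+-mono-< pq<K pq<K)
        where pq<K = ℕₚ.≤-<-trans (ℕₚ.*-monoʳ-≤ ‖p‖ q≤r) far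

      step : ∀ (s : Avoids x p) → (∃ Goal ⊎ Near c) ⊎ ∃ λ s′ → ∣ K (proj₁ s′) ∣ <ℕ ∣ K (proj₁ s) ∣
      step (w , avw) with ∣ K w ∣ ℕ.≤? ‖p‖ ℕ.* r
      ... | yes near = inj₁ (inj₂ (w , avw , near))
      ... | no far with centred-or-blocked avw
      ...   | inj₁ goal = inj₁ (inj₁ (w , goal))
      ...   | inj₂ (q , (q≤r , q∦p) , av₊ , av₋)
              with closer (K w) (cross p q) (nonzero⇒1≤∣∣ q∦p) (short-step w q (ℕₚ.≰⇒> far) q≤r)
      ...     | inj₁ lt = inj₂ ((w ⊕ neg q , av₋) , subst (λ k′ → ∣ k′ ∣ <ℕ ∣ K w ∣) (sym (K-retreat w q)) lt)
      ...     | inj₂ lt = inj₂ ((w ⊕ q , av₊) , subst (λ k′ → ∣ k′ ∣ <ℕ ∣ K w ∣) (sym (K-advance w q)) lt)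

  module Centring (D : Dominant p) (w* : ℤ²) (av* : IsAvoidance x p w*) where
    open Dominant D

    -- Twice the offset, in the dominant coordinate, of the midpoint of (w*, w* + p) from c.
    offset : ℤ² → ℤ
    offset c = + 2 * sel (w* ⊟ c) + sel p

    offset-shift : ∀ c d → offset (c ⊕ d) ≡ offset c - + 2 * sel d
    offset-shift c d = begin
      + 2 * sel (w* ⊟ (c ⊕ d)) + sel p            ≡⟨ cong (λ u → + 2 * sel u + sel p) (⊟-⊕ w* c d) ⟩
      + 2 * sel ((w* ⊟ c) ⊕ neg d) + sel p        ≡⟨ cong (λ s → + 2 * s + sel p) (sel-⊕ (w* ⊟ c) (neg d)) ⟩
      + 2 * (sel (w* ⊟ c) + sel (neg d)) + sel p
        ≡⟨ cong (λ s → + 2 * (sel (w* ⊟ c) + s) + sel p) (sel-neg d) ⟩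
      + 2 * (sel (w* ⊟ c) + - sel d) + sel p      ≡⟨ lemma (sel (w* ⊟ c)) (sel d) (sel p) ⟩
      offset c - + 2 * sel d                      ∎
      where
        open ≡-Reasoning
        lemma : ∀ s e a → + 2 * (s + - e) + a ≡ (+ 2 * s + a) - + 2 * e
        lemma = solve-∀

    offset-retreat : ∀ c → offset (c ⊕ neg p) ≡ offset c + + 2 * sel p
    offset-retreat c = begin
      offset (c ⊕ neg p)              ≡⟨ offset-shift c (neg p) ⟩
      offset c - + 2 * sel (neg p)    ≡⟨ cong (λ e → offset c - + 2 * e) (sel-neg p) ⟩
      offset c - + 2 * (- sel p)      ≡⟨ lemma (offset c) (sel p) ⟩
      offset c + + 2 * sel p          ∎
      where
        open ≡-Reasoning
        lemma : ∀ m a → m - + 2 * (- a) ≡ m + + 2 * a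
        lemma = solve-∀

    State : Set
    State = Σ ℤ² λ c → Covered c × ∣ cross p (w* ⊟ c) ∣ ≤ℕ ‖p‖ ℕ.* r

    Progress : ℤ² → Set
    Progress c = ∃ Goal ⊎ ∃ λ (s′ : State) → ∣ offset (proj₁ s′) ∣ <ℕ ∣ offset c ∣

    centred : ∀ c → ∣ cross p (w* ⊟ c) ∣ ≤ℕ ‖p‖ ℕ.* r → ∣ offset c ∣ ≤ℕ ∣ sel p ∣ → AvoidsIn x c R p
    centred c close small =
      w* , av* , box r u u-sel close , subst (λ v → ‖ v ‖∞ ≤ℕ R) (sym (⊕-⊟ w* p c)) up∈B
      where
        u = w* ⊟ c
        sel-bounds = halves (sel u) (sel p) small
        u-sel : ∣ sel u ∣ ≤ℕ ‖p‖
        u-sel = subst (∣ sel u ∣ ≤ℕ_) sel-p (proj₁ sel-bounds)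
        up-sel : ∣ sel (u ⊕ p) ∣ ≤ℕ ‖p‖
        up-sel = subst₂ _≤ℕ_ (cong ∣_∣ (sym (sel-⊕ u p))) sel-p (proj₂ sel-bounds)
        up-close : ∣ cross p (u ⊕ p) ∣ ≤ℕ ‖p‖ ℕ.* r
        up-close = subst (λ K → ∣ K ∣ ≤ℕ ‖p‖ ℕ.* r) (sym (cross-parallel p u p (cross-self p))) close
        up∈B : ‖ u ⊕ p ‖∞ ≤ℕ R
        up∈B = box r (u ⊕ p) up-sel up-close

    move : ∀ {c} → Covered c → ∣ cross p (w* ⊟ c) ∣ ≤ℕ ‖p‖ ℕ.* r
      → ∀ d → cross p d ≡ 0ℤ → ‖ d ‖∞ ≡ ‖p‖ → (AvoidsIn x c R d → AvoidsIn x c R p)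
      → ∣ offset (c ⊕ d) ∣ <ℕ ∣ offset c ∣ → Progress c
    move {c} cov close d pd≡0 ‖d‖ toP shrinks with shift d ‖d‖ toP cov
    ... | inj₁ goal = inj₁ (c , goal)
    ... | inj₂ cov′ = inj₂ ((c ⊕ d , cov′ , close′) , shrinks)
      where
        same-distance : cross p (w* ⊟ (c ⊕ d)) ≡ cross p (w* ⊟ c)
        same-distance = trans (cong (cross p) (⊟-⊕ w* c d))
                              (cross-parallel p (w* ⊟ c) (neg d) (parallel-neg p pd≡0))
        close′ = subst (λ K → ∣ K ∣ ≤ℕ ‖p‖ ℕ.* r) (sym same-distance) close

    centre : State → ∃ Goal
    centre = descend (λ (c , _) → ∣ offset c ∣) step
      where
        step : ∀ (s : State) → Progress (proj₁ s)
        step (c , cov , close) with ∣ offset c ∣ ℕ.≤? ∣ sel p ∣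
        ... | yes small = inj₁ (c , covered⇒goal (centred c close small) cov)
        ... | no large with closer-double (offset c) (sel p)
                              (subst (1 ≤ℕ_) (sym sel-p) (norm-pos p p≢0)) (ℕₚ.≰⇒> large)
        ...   | inj₁ lt = move cov close p (cross-self p) refl (λ av → av)
                            (subst (λ m → ∣ m ∣ <ℕ ∣ offset c ∣) (sym (offset-shift c p)) lt)
        ...   | inj₂ lt = move cov close (neg p) (cross-neg-self p) (norm-neg p) avoidsIn-neg
                            (subst (λ m → ∣ m ∣ <ℕ ∣ offset c ∣) (sym (offset-retreat c)) lt)

  extend : Avoids x p → ∃ Covered → ∃ Goal
  extend avp (c , cov) with walk c avp
  ... | inj₁ goal               = goal
  ... | inj₂ (w* , av* , close) = Centring.centre (dominant p p≢0) w* av* (c , cov , close)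

lemma5 : (k : ℕ) (P : List ℤ²) (x : Config k)
    → All (λ p → p ≢ origin) P
    → AllPairs (λ p q → ¬ Colinear p q) P
    → All (Avoids x) P
    → ∃ λ c → All (λ p → ∃ λ w → IsAvoidance x p w × (w ∈B[ c , normSum P ]) × ((w ⊕ p) ∈B[ c , normSum P ])) P
lemma5 k []       x _             _               _          = origin , []
lemma5 k (p ∷ P′) x (p≢0 ∷ P′≢0) (p∦P′ ∷ P′-pairs) (avp ∷ avs) =
  Extend.extend x p (normSum P′) P′ p≢0 (norm≤normSum P′) (All.map (non-colinear⇒cross≢0 p) p∦P′) avp
    (lemma5 k P′ x P′≢0 P′-pairs avs)
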